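{- Let $\Lambda$ be a numerical semigroup of rank $k$ with $1\le k\le 3$, multiplicity $m=\lambda_1$, $u=\lambda_2-\lambda_1$ and $v=\lambda_3-\lambda_2$. Then: (1) If $k=1$, so $\Lambda=\{0\}\cup\{n\in\mathbb N:n\ge m\}$, then $G(\Lambda)=(2^{m-1}-1)_b$ and $S(\Lambda)=(2^m-1)_b$. (2) If $k=2$, so $\Lambda=\{0,m\}\cup\{n: n\ge m+u\}$, then $1<u\le m$ and $G(\Lambda)=(2^{m+u-1}-1-2^{m-1})_b$, $S(\Lambda)=(2^{m+u}-1-2^{m-u})_b$. (3) If $k=3$, so $\Lambda=\{0,m,m+u\}\cup\{n:n\ge m+u+v\}$: (i) if $1\le u<m$, then $2\le v\le m-u$ and $G(\Lambda)=(2^{m+u+v-1}-1-2^{m-1}-2^{m+u-1})_b$, $S(\Lambda)=(2^{m+u+v}-1-2^{m-u-v}-2^{m-v}-2^{m+u-v})_b$; (ii) if $u=m$, then $2\le v\le m$ and $G(\Lambda)=(2^{m+u+v-1}-1-2^{m-1}-2^{m+u-1})_b$, $S(\Lambda)=(2^{m+u+v}-1-2^{m-v}-2^{m+u-v})_b$.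
   Context: A numerical semigroup is a cofinite submonoid of $\mathbb N$, with elements $\lambda_0=0<\lambda_1<\dots$. The genus $g$ is the number of gaps, the conductor $c$ is the largest gap plus one, the rank is $k=c-g$ (so $\lambda_k=c$ and $\lambda_0,\dots,\lambda_{k-1}$ are the elements of $\Lambda$ below $c$). For $p<k$, an element $\lambda_s\ge c$ of $\Lambda$ is an order-$p$ seed if $\lambda_s+\lambda_p\neq\lambda_i+\lambda_j$ for all $p<i\le j<s$. The gap bitstream is $G(\Lambda)=G_0\dots G_{c-1}$ with $G_i=0$ if $i+1\in\Lambda$ and $G_i=1$ otherwise. The seed bitstream is $S(\Lambda)=S_0\dots S_{c-1}$ where, for $0\le i\le c-1$, letting $j$ be the unique index with $\lambda_j\le i<\lambda_{j+1}$, $S_i=1$ if $c+i-\lambda_j$ is an order-$j$ seed and $S_i=0$ otherwise. For $n\in\mathbb N$, $(n)_b=a_0a_1\dots a_\ell$ is the binary representation $n=\sum_i a_i2^i$ written least significant bit first; bitstreams differing only by trailing zeros are identified. -}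

module Defs where

open import Data.Bool using (Bool; true; false; if_then_else_)
open import Data.Nat using (ℕ; zero; suc; _+_; _∸_; _≤_; _<_; _%_; _/_; _≡ᵇ_)
open import Data.Product using (Σ; ∃; ∃-syntax; _×_; _,_)
open import Data.Sum using (_⊎_)
open import Relation.Nullary using (¬_)
open import Relation.Binary.PropositionalEquality using (_≡_)
open import Function.Bundles using (_⇔_)

record NumericalSemigroup : Set where
  field
    mem      : ℕ → Bool
    zero∈    : mem 0 ≡ true
    closed   : ∀ a b → mem a ≡ true → mem b ≡ true → mem (a + b) ≡ true
    cofinite : ∃[ c ] (∀ n → c ≤ n → mem n ≡ true)

open NumericalSemigroup public

infix 4 _∈_ _∉_
_∈_ : ℕ → NumericalSemigroup → Set
n ∈ Λ = mem Λ n ≡ true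

_∉_ : ℕ → NumericalSemigroup → Set
n ∉ Λ = ¬ (n ∈ Λ)

countElems : NumericalSemigroup → ℕ → ℕ
countElems Λ zero    = 0
countElems Λ (suc x) = countElems Λ x + (if mem Λ x then 1 else 0)

countGaps : NumericalSemigroup → ℕ → ℕ
countGaps Λ zero    = 0
countGaps Λ (suc x) = countGaps Λ x + (if mem Λ x then 0 else 1)

-- λ_i = x : x is the i-th element of Λ (λ_0 = 0 < λ_1 < ...)
IsElem : NumericalSemigroup → ℕ → ℕ → Set
IsElem Λ i x = (x ∈ Λ) × (countElems Λ x ≡ i)

IsConductor : NumericalSemigroup → ℕ → Set
IsConductor Λ c =
  ((c ≡ 0) × (∀ n → n ∈ Λ))
  ⊎ (∃[ g ] ((c ≡ suc g) × (g ∉ Λ) × (∀ n → g < n → n ∈ Λ)))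

-- genus (number of gaps; all gaps lie below the conductor c)
genus : NumericalSemigroup → ℕ → ℕ
genus Λ c = countGaps Λ c

rank : NumericalSemigroup → ℕ → ℕ
rank Λ c = c ∸ genus Λ c

IsOrderSeed : NumericalSemigroup → ℕ → ℕ → ℕ → Set
IsOrderSeed Λ c p s =
  ∀ lp ls → IsElem Λ p lp → IsElem Λ s ls →
    (p < rank Λ c) × (c ≤ ls) ×
    (∀ i j li lj → IsElem Λ i li → IsElem Λ j lj →
       p < i → i ≤ j → j < s → ¬ (ls + lp ≡ li + lj))

-- A bitstream modulo trailing zeros is represented by its bit function ℕ → Bool
-- (bits beyond the end are false).

-- i-th bit of the binary representation (n)_b, least significant first
bitOf : ℕ → ℕ → Bool
bitOf n zero    = n % 2 ≡ᵇ 1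
bitOf n (suc i) = bitOf (n / 2) i

IsGapBitstream : NumericalSemigroup → ℕ → (ℕ → Bool) → Set
IsGapBitstream Λ c bs =
  ∀ i → (i < c → ((bs i ≡ true) ⇔ (suc i ∉ Λ))) × (c ≤ i → bs i ≡ false)

IsSeedBitstream : NumericalSemigroup → ℕ → (ℕ → Bool) → Set
IsSeedBitstream Λ c bs =
  ∀ i → (i < c → ((bs i ≡ true) ⇔
           (∃[ j ] ∃[ lj ] ∃[ lj' ] (IsElem Λ j lj × IsElem Λ (suc j) lj' × lj ≤ i × i < lj' ×
              ∃[ s ] (IsElem Λ s (c + i ∸ lj) × IsOrderSeed Λ c j s)))))
        × (c ≤ i → bs i ≡ false)

-- Below its conductor c a numerical semigroup of rank k has only the elements
-- 0 = λ₀ < … < λ_{k-1}, and subtracting distinct powers 2^p (p < a) from 2^a - 1 just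
-- clears the bits p.  So G(Λ) is 2^{c-1} - 1 with the bits λ_j - 1 (0 < j < k) cleared.
-- For i < c and λ_j ≤ i < λ_{j+1}, the element c + i - λ_j is an order-j seed exactly
-- when c + i is not a sum λ_a + λ_b with a ≤ b < k (any such sum has λ_a > i, i.e. a > j),
-- so S(Λ) is 2^c - 1 with the bits (λ_a + λ_b) - c cleared.  For k = 3 these sums are
-- 2m, 2m + u and 2m + 2u; closure of Λ under them forces v ≤ m, and v ≤ m - u when u < m.

module Submission where

open import Defs
open import Data.Bool using (Bool; true; false; if_then_else_; T)
open import Data.Bool.Properties using (¬-not; T-≡)
open import Data.Empty using (⊥; ⊥-elim)
open import Data.List using (List; []; _∷_)
open import Data.List.Membership.Propositional using () renaming (_∈_ to _∈ₗ_; _∉_ to _∉ₗ_)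
open import Data.List.Relation.Unary.All as All using (All; []; _∷_)
open import Data.List.Relation.Unary.Any using (here; there)
open import Data.List.Relation.Unary.Unique.Propositional using (Unique)
open import Data.List.Relation.Unary.AllPairs using ([]; _∷_)
open import Data.Nat
open import Data.Nat.DivMod using (_/_; m*n%n≡0; [m+kn]%n≡m%n; m*n/n≡m; +-distrib-/)
open import Data.Nat.Properties
open import Data.Nat.Tactic.RingSolver using (solve-∀)
open import Data.Product using (_×_; _,_; proj₁; proj₂; ∃-syntax)
open import Data.Product.Function.NonDependent.Propositional using (_×-⇔_)
open import Data.Sum using (_⊎_; inj₁; inj₂; [_,_]′; map₂)
open import Function using (case_of_; id; _∘_)
open import Function.Bundles using (_⇔_; mk⇔; Equivalence)
open import Function.Construct.Composition using (_⇔-∘_)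
open import Function.Construct.Identity using (⇔-id)
open import Relation.Nullary using (¬_; contradiction)
open import Relation.Binary.PropositionalEquality

open Equivalence using (to; from)

bitValue : Bool → ℕ
bitValue false = 0
bitValue true  = 1

data Halving : ℕ → Set where
  halve : ∀ b q → Halving (bitValue b + q * 2)

halving : ∀ n → Halving n
halving zero = halve false 0
halving (suc n) with halving n
... | halve false q = halve true q
... | halve true  q = halve false (suc q)

bitOf-halve-zero : ∀ b q → bitOf (bitValue b + q * 2) 0 ≡ b
bitOf-halve-zero false q = cong (_≡ᵇ 1) (m*n%n≡0 q 2)
bitOf-halve-zero true  q = cong (_≡ᵇ 1) ([m+kn]%n≡m%n 1 q 2)

[bitValue+q*2]/2≡q : ∀ b q → (bitValue b + q * 2) / 2 ≡ q
[bitValue+q*2]/2≡q false q = m*n/n≡m q 2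
[bitValue+q*2]/2≡q true  q = begin
  (1 + q * 2) / 2   ≡⟨ +-distrib-/ 1 (q * 2) (subst (λ r → 1 + r < 2) (sym (m*n%n≡0 q 2)) ≤-refl) ⟩
  1 / 2 + q * 2 / 2 ≡⟨ cong (0 +_) (m*n/n≡m q 2) ⟩
  q                 ∎
  where open ≡-Reasoning

bitOf-halve-suc : ∀ b q i → bitOf (bitValue b + q * 2) (suc i) ≡ bitOf q i
bitOf-halve-suc b q i = cong (λ n → bitOf n i) ([bitValue+q*2]/2≡q b q)

bitOf-zero : ∀ i → bitOf 0 i ≡ false
bitOf-zero zero    = refl
bitOf-zero (suc i) = bitOf-zero i

2^[1+a]∸1 : ∀ a → 2 ^ suc a ∸ 1 ≡ 1 + (2 ^ a ∸ 1) * 2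
2^[1+a]∸1 a with 2 ^ a | m^n>0 2 a
... | suc t | _ = trans (+-suc t (t + 0)) (cong suc (*-comm 2 t))

bitOf-2^∸1 : ∀ a i → bitOf (2 ^ a ∸ 1) i ≡ (i <ᵇ a)
bitOf-2^∸1 zero    i       = bitOf-zero i
bitOf-2^∸1 (suc a) zero    rewrite 2^[1+a]∸1 a = bitOf-halve-zero true (2 ^ a ∸ 1)
bitOf-2^∸1 (suc a) (suc i) rewrite 2^[1+a]∸1 a =
  trans (bitOf-halve-suc true (2 ^ a ∸ 1) i) (bitOf-2^∸1 a i)

bitOf-2^∸1-⇔ : ∀ {a i} → bitOf (2 ^ a ∸ 1) i ≡ true ⇔ i < a
bitOf-2^∸1-⇔ {a} {i} rewrite bitOf-2^∸1 a i = mk⇔ (<ᵇ⇒< i a ∘ from T-≡) (to T-≡ ∘ <⇒<ᵇ)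

*2-mono-≤ : ∀ {x q} → x ≤ q → 2 * x ≤ q * 2
*2-mono-≤ {q = q} x≤q = ≤-trans (*-monoʳ-≤ 2 x≤q) (≤-reflexive (*-comm 2 q))

bitOf⇒2^≤ : ∀ n b → bitOf n b ≡ true → 2 ^ b ≤ n
bitOf⇒2^≤ n b h with halving n
bitOf⇒2^≤ _ zero    h | halve false q = contradiction (trans (sym h) (bitOf-halve-zero false q)) λ ()
bitOf⇒2^≤ _ zero    h | halve true  q = s≤s z≤n
bitOf⇒2^≤ _ (suc b) h | halve r     q =
  ≤-trans (*2-mono-≤ (bitOf⇒2^≤ q b (trans (sym (bitOf-halve-suc r q b)) h))) (m≤n+m (q * 2) (bitValue r))

halve∸2^[1+b] : ∀ r q b → 2 ^ b ≤ q → bitValue r + q * 2 ∸ 2 ^ suc b ≡ bitValue r + (q ∸ 2 ^ b) * 2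
halve∸2^[1+b] r q b h = begin
  bitValue r + q * 2 ∸ 2 * 2 ^ b   ≡⟨ +-∸-assoc (bitValue r) (*2-mono-≤ h) ⟩
  bitValue r + (q * 2 ∸ 2 * 2 ^ b) ≡⟨ cong (λ x → bitValue r + (q * 2 ∸ x)) (*-comm 2 (2 ^ b)) ⟩
  bitValue r + (q * 2 ∸ 2 ^ b * 2) ≡⟨ cong (bitValue r +_) (sym (*-distribʳ-∸ 2 q (2 ^ b))) ⟩
  bitValue r + (q ∸ 2 ^ b) * 2     ∎
  where open ≡-Reasoning

bitOf-∸-2^ : ∀ n b i → bitOf n b ≡ true →
             bitOf (n ∸ 2 ^ b) i ≡ (if i ≡ᵇ b then false else bitOf n i)
bitOf-∸-2^ n b i h with halving n
bitOf-∸-2^ _ zero    i       h | halve false q = contradiction (trans (sym h) (bitOf-halve-zero false q)) λ ()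
bitOf-∸-2^ _ zero    zero    h | halve true  q = bitOf-halve-zero false q
bitOf-∸-2^ _ zero    (suc i) h | halve true  q = trans (bitOf-halve-suc false q i) (sym (bitOf-halve-suc true q i))
bitOf-∸-2^ _ (suc b) i       h | halve r     q
  rewrite halve∸2^[1+b] r q b (bitOf⇒2^≤ q b (trans (sym (bitOf-halve-suc r q b)) h)) = lower i
  where
  lower : ∀ i → bitOf (bitValue r + (q ∸ 2 ^ b) * 2) i
              ≡ (if i ≡ᵇ suc b then false else bitOf (bitValue r + q * 2) i)
  lower zero    = trans (bitOf-halve-zero r (q ∸ 2 ^ b)) (sym (bitOf-halve-zero r q))
  lower (suc i) = begin
    bitOf (bitValue r + (q ∸ 2 ^ b) * 2) (suc i)
      ≡⟨ bitOf-halve-suc r (q ∸ 2 ^ b) i ⟩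
    bitOf (q ∸ 2 ^ b) i
      ≡⟨ bitOf-∸-2^ q b i (trans (sym (bitOf-halve-suc r q b)) h) ⟩
    (if i ≡ᵇ b then false else bitOf q i)
      ≡⟨ cong (if i ≡ᵇ b then false else_) (sym (bitOf-halve-suc r q i)) ⟩
    (if i ≡ᵇ b then false else bitOf (bitValue r + q * 2) (suc i)) ∎
    where open ≡-Reasoning

bitOf-∸-2^-⇔ : ∀ {n b i} → bitOf n b ≡ true → bitOf (n ∸ 2 ^ b) i ≡ true ⇔ (i ≢ b × bitOf n i ≡ true)
bitOf-∸-2^-⇔ {n} {b} {i} h rewrite bitOf-∸-2^ n b i h with i ≡ᵇ b in i≡ᵇb
... | true  = mk⇔ (λ ()) (λ (i≢b , _) → contradiction (≡ᵇ⇒≡ i b (from T-≡ i≡ᵇb)) i≢b)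
... | false = mk⇔ ((λ { refl → subst T i≡ᵇb (≡⇒≡ᵇ i i refl) }) ,_) proj₂

clearBits : ℕ → List ℕ → ℕ
clearBits n []       = n
clearBits n (p ∷ ps) = clearBits (n ∸ 2 ^ p) ps

bitOf-clearBits : ∀ {n i} ps → Unique ps → All (λ p → bitOf n p ≡ true) ps →
                  bitOf (clearBits n ps) i ≡ true ⇔ (i ∉ₗ ps × bitOf n i ≡ true)
bitOf-clearBits []       []                 []          = mk⇔ ((λ ()) ,_) proj₂
bitOf-clearBits {n} {i} (p ∷ ps) (p∉ps ∷ uniq) (set-p ∷ set-ps) = mk⇔ ⇒ ⇐
  where
  still-set : All (λ q → bitOf (n ∸ 2 ^ p) q ≡ true) ps
  still-set = All.zipWith (λ (p≢q , set-q) → from (bitOf-∸-2^-⇔ set-p) ((λ q≡p → p≢q (sym q≡p)) , set-q))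
                          (p∉ps , set-ps)
  rest : bitOf (clearBits (n ∸ 2 ^ p) ps) i ≡ true ⇔ (i ∉ₗ ps × bitOf (n ∸ 2 ^ p) i ≡ true)
  rest = bitOf-clearBits ps uniq still-set
  ⇒ : bitOf (clearBits (n ∸ 2 ^ p) ps) i ≡ true → i ∉ₗ p ∷ ps × bitOf n i ≡ true
  ⇒ h with to rest h
  ... | i∉ps , h′ with to (bitOf-∸-2^-⇔ set-p) h′
  ...   | i≢p , set-i = (λ { (here i≡p) → i≢p i≡p ; (there i∈ps) → i∉ps i∈ps }) , set-i
  ⇐ : i ∉ₗ p ∷ ps × bitOf n i ≡ true → bitOf (clearBits (n ∸ 2 ^ p) ps) i ≡ true
  ⇐ (i∉ , set-i) = from rest ((λ i∈ps → i∉ (there i∈ps)) , from (bitOf-∸-2^-⇔ set-p) ((λ i≡p → i∉ (here i≡p)) , set-i))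

bitOf-clearBits-2^∸1 : ∀ {a i ps} → Unique ps → All (_< a) ps →
                       bitOf (clearBits (2 ^ a ∸ 1) ps) i ≡ true ⇔ (i ∉ₗ ps × i < a)
bitOf-clearBits-2^∸1 {ps = ps} uniq ps<a =
  (⇔-id _ ×-⇔ bitOf-2^∸1-⇔) ⇔-∘ bitOf-clearBits ps uniq (All.map (from bitOf-2^∸1-⇔) ps<a)

m+n≡o+p∧n<o⇒p<m : ∀ {m n o p} → m + n ≡ o + p → n < o → p < m
m+n≡o+p∧n<o⇒p<m {o = o} {p} eq n<o =
  ≰⇒> λ m≤p → <-irrefl (trans eq (+-comm o p)) (+-mono-≤-< m≤p n<o)

m+n≡o+p∧p<m⇒n<o : ∀ {m n o p} → m + n ≡ o + p → p < m → n < o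
m+n≡o+p∧p<m⇒n<o {o = o} {p} eq p<m =
  ≰⇒> λ o≤n → <-irrefl (trans (+-comm p o) (sym eq)) (+-mono-<-≤ p<m o≤n)

o<m∧m+n≡p⇒n<p∸o : ∀ {m n o p} → o < m → m + n ≡ p → n < p ∸ o
o<m∧m+n≡p⇒n<p∸o {m} {n} {o} o<m eq =
  m+n≤o⇒m≤o∸n (suc n) (subst (suc (n + o) ≤_) (trans (+-comm n m) eq) (+-monoʳ-< n o<m))

m+n≡o+p∧n<o⇒0<m : ∀ {m n o p} → m + n ≡ o + p → n < o → 0 < m
m+n≡o+p∧n<o⇒0<m eq n<o = ≤-<-trans z≤n (m+n≡o+p∧n<o⇒p<m eq n<o)

m+n+o≡m+p⇒o≡p∸n : ∀ m n {o p} → m + n + o ≡ m + p → o ≡ p ∸ n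
m+n+o≡m+p⇒o≡p∸n m n {o} {p} eq =
  trans (sym (m+n∸m≡n n o)) (cong (_∸ n) (+-cancelˡ-≡ m (n + o) p (trans (sym (+-assoc m n o)) eq)))

n≤p⇒m+n+[p∸n]≡m+p : ∀ {m n p} → n ≤ p → m + n + (p ∸ n) ≡ m + p
n≤p⇒m+n+[p∸n]≡m+p {m} n≤p = trans (+-assoc m _ _) (cong (m +_) (m+[n∸m]≡n n≤p))

<∸1⇔suc< : ∀ {i c} → i < c ∸ 1 ⇔ suc i < c
<∸1⇔suc< {c = zero}  = mk⇔ (λ ()) (λ ())
<∸1⇔suc< {c = suc c} = mk⇔ s<s s<s⁻¹

module Elements (Λ : NumericalSemigroup) where

  countElems-∈ : ∀ {x} → x ∈ Λ → countElems Λ (suc x) ≡ suc (countElems Λ x)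
  countElems-∈ {x} x∈Λ rewrite x∈Λ = +-comm (countElems Λ x) 1

  countElems-mono : ∀ {x y} → x ≤ y → countElems Λ x ≤ countElems Λ y
  countElems-mono {y = zero}  z≤n = ≤-refl
  countElems-mono {y = suc y} x≤y with m≤n⇒m<n∨m≡n x≤y
  ... | inj₁ x<1+y = ≤-trans (countElems-mono (m<1+n⇒m≤n x<1+y)) (m≤m+n _ _)
  ... | inj₂ refl  = ≤-refl

  countElems-<-∈ : ∀ {x y} → x ∈ Λ → x < y → suc (countElems Λ x) ≤ countElems Λ y
  countElems-<-∈ {y = y} x∈Λ x<y = subst (_≤ countElems Λ y) (countElems-∈ x∈Λ) (countElems-mono x<y)

  countElems+countGaps : ∀ x → countElems Λ x + countGaps Λ x ≡ x
  countElems+countGaps zero = refl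
  countElems+countGaps (suc x) with mem Λ x
  ... | true  = trans (shift (countElems Λ x) (countGaps Λ x)) (cong suc (countElems+countGaps x))
    where shift : ∀ a b → a + 1 + (b + 0) ≡ suc (a + b)
          shift = solve-∀
  ... | false = trans (shift (countElems Λ x) (countGaps Λ x)) (cong suc (countElems+countGaps x))
    where shift : ∀ a b → a + 0 + (b + 1) ≡ suc (a + b)
          shift = solve-∀

  rank≡countElems : ∀ c → rank Λ c ≡ countElems Λ c
  rank≡countElems c =
    trans (cong (_∸ countGaps Λ c) (sym (countElems+countGaps c))) (m+n∸n≡m (countElems Λ c) (countGaps Λ c))

  IsElem-zero : IsElem Λ 0 0
  IsElem-zero = zero∈ Λ , refl

  IsElem-index-mono-≤ : ∀ {i j x y} → IsElem Λ i x → IsElem Λ j y → x ≤ y → i ≤ j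
  IsElem-index-mono-≤ (_ , refl) (_ , refl) = countElems-mono

  IsElem-index-mono-< : ∀ {i j x y} → IsElem Λ i x → IsElem Λ j y → x < y → i < j
  IsElem-index-mono-< (x∈Λ , refl) (_ , refl) = countElems-<-∈ x∈Λ

  IsElem-mono-< : ∀ {i j x y} → IsElem Λ i x → IsElem Λ j y → i < j → x < y
  IsElem-mono-< ex ey i<j = ≰⇒> λ y≤x → <⇒≱ i<j (IsElem-index-mono-≤ ey ex y≤x)

  IsElem-mono-≤ : ∀ {i j x y} → IsElem Λ i x → IsElem Λ j y → i ≤ j → x ≤ y
  IsElem-mono-≤ ex ey i≤j = ≮⇒≥ λ y<x → <⇒≱ (IsElem-index-mono-< ey ex y<x) i≤j

  IsElem-unique : ∀ {i x y} → IsElem Λ i x → IsElem Λ i y → x ≡ y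
  IsElem-unique ex ey = ≤-antisym (IsElem-mono-≤ ex ey ≤-refl) (IsElem-mono-≤ ey ex ≤-refl)

  IsElem-next : ∀ {j x y n} → IsElem Λ j x → IsElem Λ (suc j) y → n ∈ Λ → x < n → y ≤ n
  IsElem-next ex ey n∈Λ x<n = ≮⇒≥ λ n<y →
    <⇒≱ (IsElem-index-mono-< ex (n∈Λ , refl) x<n) (s≤s⁻¹ (IsElem-index-mono-< (n∈Λ , refl) ey n<y))

  IsElem-cases : ∀ {j x y n} → IsElem Λ j x → IsElem Λ (suc j) y → n ∈ Λ → x ≤ n → n ≡ x ⊎ y ≤ n
  IsElem-cases ex ey n∈Λ x≤n with m≤n⇒m<n∨m≡n x≤n
  ... | inj₁ x<n = inj₂ (IsElem-next ex ey n∈Λ x<n)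
  ... | inj₂ x≡n = inj₁ (sym x≡n)

  countElems-suc-cases : ∀ {x j} → j < countElems Λ (suc x) → j < countElems Λ x ⊎ (j ≡ countElems Λ x × x ∈ Λ)
  countElems-suc-cases {x} {j} j< with mem Λ x
  ... | false = inj₁ (subst (j <_) (+-identityʳ _) j<)
  ... | true with m<1+n⇒m<n∨m≡n (subst (j <_) (+-comm _ 1) j<)
  ...   | inj₁ j<cx = inj₁ j<cx
  ...   | inj₂ j≡cx = inj₂ (j≡cx , refl)

  IsElem-exists : ∀ x {j} → j < countElems Λ x → ∃[ y ] (y < x × IsElem Λ j y)
  IsElem-exists (suc x) j< with countElems-suc-cases j<
  ... | inj₁ j<cx with IsElem-exists x j<cx
  ...   | y , y<x , ey = y , m<n⇒m<1+n y<x , ey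
  IsElem-exists (suc x) j< | inj₂ (refl , x∈Λ) = x , ≤-refl , x∈Λ , refl

  IsElem-bracket : ∀ {c i} → c ∈ Λ → i < c →
                   ∃[ j ] ∃[ x ] ∃[ y ] (IsElem Λ j x × IsElem Λ (suc j) y × x ≤ i × i < y)
  IsElem-bracket {c} {i} c∈Λ i<c with countElems Λ (suc i) in count
  ... | zero  = contradiction (subst (1 ≤_) count (countElems-<-∈ (zero∈ Λ) z<s)) λ ()
  ... | suc j with IsElem-exists (suc i) (subst (j <_) (sym count) ≤-refl)
                 | IsElem-exists (suc c) (≤-trans (s≤s (subst (_≤ countElems Λ c) count (countElems-mono i<c)))
                                                  (countElems-<-∈ c∈Λ ≤-refl))
  ...   | x , x<1+i , ex | y , _ , ey@(y∈Λ , cy) =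
    j , x , y , ex , ey , s≤s⁻¹ x<1+i , ≰⇒> λ y≤i →
      1+n≰n (subst₂ _≤_ (cong suc cy) count (countElems-<-∈ y∈Λ (s≤s y≤i)))

SeedAt : NumericalSemigroup → ℕ → ℕ → Set
SeedAt Λ c i = ∃[ j ] ∃[ lj ] ∃[ lj' ] (IsElem Λ j lj × IsElem Λ (suc j) lj' × lj ≤ i × i < lj' ×
                 ∃[ s ] (IsElem Λ s (c + i ∸ lj) × IsOrderSeed Λ c j s))

IsSumBelow : NumericalSemigroup → ℕ → ℕ → Set
IsSumBelow Λ c n = ∃[ x ] ∃[ y ] (x ∈ Λ × y ∈ Λ × x ≤ y × y < c × x + y ≡ n)

module Conductor (Λ : NumericalSemigroup) (c : ℕ) where

  open Elements Λ

  ≥conductor⇒∈ : IsConductor Λ c → ∀ {n} → c ≤ n → n ∈ Λ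
  ≥conductor⇒∈ (inj₁ (_ , all∈Λ))              _ = all∈Λ _
  ≥conductor⇒∈ (inj₂ (_ , refl , _ , above-g)) g<n = above-g _ g<n

  ∉⇒<conductor : IsConductor Λ c → ∀ {n} → n ∉ Λ → n < c
  ∉⇒<conductor cond n∉Λ = ≰⇒> λ c≤n → n∉Λ (≥conductor⇒∈ cond c≤n)

  IsElem-rank-conductor : IsConductor Λ c → IsElem Λ (rank Λ c) c
  IsElem-rank-conductor cond = ≥conductor⇒∈ cond ≤-refl , sym (rank≡countElems c)

  IsElem-rank≡conductor : IsConductor Λ c → ∀ {k x} → rank Λ c ≡ k → IsElem Λ k x → x ≡ c
  IsElem-rank≡conductor cond refl ex = IsElem-unique ex (IsElem-rank-conductor cond)

  ∈∧<conductor⇒suc<conductor : IsConductor Λ c → ∀ {x} → x ∈ Λ → x < c → suc x < c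
  ∈∧<conductor⇒suc<conductor (inj₁ (refl , _))         _    ()
  ∈∧<conductor⇒suc<conductor (inj₂ (g , refl , g∉Λ , _)) x∈Λ x<c =
    s<s (≤∧≢⇒< (s≤s⁻¹ x<c) λ { refl → g∉Λ x∈Λ })

  IsSumBelow-offset< : ∀ {p} → IsSumBelow Λ c (c + p) → p < c
  IsSumBelow-offset< {p} (x , y , _ , _ , x≤y , y<c , sum) =
    +-cancelˡ-< c p c (subst (_< c + c) sum (+-mono-< (≤-<-trans x≤y y<c) y<c))

  seedAt⇒¬IsSumBelow : ∀ {i} → SeedAt Λ c i → ¬ IsSumBelow Λ c (c + i)
  seedAt⇒¬IsSumBelow {i} (j , lj , _ , ej , _ , lj≤i , _ , s , es , seed) (x , y , x∈Λ , y∈Λ , x≤y , y<c , sum)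
    with seed lj (c + i ∸ lj) ej es
  ... | _ , _ , noSplit =
    noSplit _ _ x y (x∈Λ , refl) (y∈Λ , refl)
      (IsElem-index-mono-< ej (x∈Λ , refl) lj<x)
      (countElems-mono x≤y)
      (IsElem-index-mono-< (y∈Λ , refl) es (o<m∧m+n≡p⇒n<p∸o lj<x sum))
      (trans (m∸n+n≡m (≤-trans lj≤i (m≤n+m i c))) (sym sum))
    where
    lj<x : lj < x
    lj<x = ≤-<-trans lj≤i (m+n≡o+p∧n<o⇒p<m sum y<c)

  ¬IsSumBelow⇒seedAt : IsConductor Λ c → ∀ {i} → i < c → ¬ IsSumBelow Λ c (c + i) → SeedAt Λ c i
  ¬IsSumBelow⇒seedAt cond {i} i<c ¬sum with IsElem-bracket (≥conductor⇒∈ cond ≤-refl) i<c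
  ... | j , x , x' , ej , ej' , x≤i , i<x' = j , x , x' , ej , ej' , x≤i , i<x' , _ , (s∈Λ , refl) , seed
    where
    c≤s : c ≤ c + i ∸ x
    c≤s = subst (c ≤_) (sym (+-∸-assoc c x≤i)) (m≤m+n c (i ∸ x))
    s∈Λ : c + i ∸ x ∈ Λ
    s∈Λ = ≥conductor⇒∈ cond c≤s
    seed : IsOrderSeed Λ c j (countElems Λ (c + i ∸ x))
    seed lp ls ep es with IsElem-unique {x = lp} ep ej | IsElem-unique {x = ls} es (s∈Λ , refl)
    ... | refl | refl = IsElem-index-mono-< ej (IsElem-rank-conductor cond) (≤-<-trans x≤i i<c) , c≤s , noSplit
      where
      noSplit : ∀ a b la lb → IsElem Λ a la → IsElem Λ b lb →
                j < a → a ≤ b → b < countElems Λ (c + i ∸ x) → ¬ (c + i ∸ x + x ≡ la + lb)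
      noSplit a b la lb ea eb j<a a≤b _ eq =
        ¬sum (la , lb , proj₁ ea , proj₁ eb , IsElem-mono-≤ ea eb a≤b , m+n≡o+p∧p<m⇒n<o sum i<la , sum)
        where
        sum : la + lb ≡ c + i
        sum = trans (sym eq) (m∸n+n≡m (≤-trans x≤i (m≤n+m i c)))
        i<la : i < la
        i<la = <-≤-trans i<x' (IsElem-mono-≤ ej' ea j<a)

  gapBitstream : IsConductor Λ c → ∀ ps → Unique ps → All (λ p → suc p < c) ps → All (λ p → suc p ∈ Λ) ps →
                 (∀ i → suc i ∈ Λ → suc i < c → i ∈ₗ ps) →
                 IsGapBitstream Λ c (bitOf (clearBits (2 ^ (c ∸ 1) ∸ 1) ps))
  gapBitstream cond ps uniq bounded listed complete i = (λ _ → mk⇔ ⇒ ⇐) , vanish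
    where
    bits : bitOf (clearBits (2 ^ (c ∸ 1) ∸ 1) ps) i ≡ true ⇔ (i ∉ₗ ps × i < c ∸ 1)
    bits = bitOf-clearBits-2^∸1 uniq (All.map (from <∸1⇔suc<) bounded)
    ⇒ : bitOf (clearBits (2 ^ (c ∸ 1) ∸ 1) ps) i ≡ true → suc i ∉ Λ
    ⇒ h 1+i∈Λ = let i∉ps , i< = to bits h in i∉ps (complete i 1+i∈Λ (to <∸1⇔suc< i<))
    ⇐ : suc i ∉ Λ → bitOf (clearBits (2 ^ (c ∸ 1) ∸ 1) ps) i ≡ true
    ⇐ 1+i∉Λ = from bits ((λ i∈ps → 1+i∉Λ (All.lookup listed i∈ps)) , from <∸1⇔suc< (∉⇒<conductor cond 1+i∉Λ))
    vanish : c ≤ i → bitOf (clearBits (2 ^ (c ∸ 1) ∸ 1) ps) i ≡ false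
    vanish c≤i = ¬-not λ h → <⇒≱ (<-≤-trans (proj₂ (to bits h)) (m∸n≤m c 1)) c≤i

  seedBitstream : IsConductor Λ c → ∀ ps → Unique ps → All (λ p → IsSumBelow Λ c (c + p)) ps →
                  (∀ i → IsSumBelow Λ c (c + i) → i ∈ₗ ps) →
                  IsSeedBitstream Λ c (bitOf (clearBits (2 ^ c ∸ 1) ps))
  seedBitstream cond ps uniq sums complete i = (λ i<c → mk⇔ (⇒ i<c) (⇐ i<c)) , vanish
    where
    bits : bitOf (clearBits (2 ^ c ∸ 1) ps) i ≡ true ⇔ (i ∉ₗ ps × i < c)
    bits = bitOf-clearBits-2^∸1 uniq (All.map IsSumBelow-offset< sums)
    ⇒ : i < c → bitOf (clearBits (2 ^ c ∸ 1) ps) i ≡ true → SeedAt Λ c i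
    ⇒ i<c h = ¬IsSumBelow⇒seedAt cond i<c λ sum → proj₁ (to bits h) (complete i sum)
    ⇐ : i < c → SeedAt Λ c i → bitOf (clearBits (2 ^ c ∸ 1) ps) i ≡ true
    ⇐ i<c seed = from bits ((λ i∈ps → seedAt⇒¬IsSumBelow seed (All.lookup sums i∈ps)) , i<c)
    vanish : c ≤ i → bitOf (clearBits (2 ^ c ∸ 1) ps) i ≡ false
    vanish c≤i = ¬-not λ h → <⇒≱ (proj₂ (to bits h)) c≤i

module Rank1 {Λ : NumericalSemigroup} {m : ℕ} (cond : IsConductor Λ m) (e₁ : IsElem Λ 1 m) where

  open Elements Λ
  open Conductor Λ m

  members : ∀ n → n ∈ Λ ⇔ (n ≡ 0 ⊎ m ≤ n)
  members n = mk⇔ (λ n∈Λ → IsElem-cases IsElem-zero e₁ n∈Λ z≤n)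
                  [ (λ { refl → zero∈ Λ }) , ≥conductor⇒∈ cond ]′

  no-nonzero-small : ∀ {n} → n ∈ Λ → 0 < n → n < m → ⊥
  no-nonzero-small n∈Λ 0<n n<m = <⇒≱ n<m (IsElem-next IsElem-zero e₁ n∈Λ 0<n)

  gap : IsGapBitstream Λ m (bitOf (2 ^ (m ∸ 1) ∸ 1))
  gap = gapBitstream cond [] [] [] [] λ _ 1+i∈Λ 1+i<m → ⊥-elim (no-nonzero-small 1+i∈Λ z<s 1+i<m)

  seed : IsSeedBitstream Λ m (bitOf (2 ^ m ∸ 1))
  seed = seedBitstream cond [] [] [] λ { _ (x , y , x∈Λ , _ , x≤y , y<m , sum) →
    ⊥-elim (no-nonzero-small x∈Λ (m+n≡o+p∧n<o⇒0<m sum y<m) (≤-<-trans x≤y y<m)) }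

module Rank2 {Λ : NumericalSemigroup} {m u : ℕ} (cond : IsConductor Λ (m + u))
             (e₁ : IsElem Λ 1 m) (e₂ : IsElem Λ 2 (m + u)) where

  open Elements Λ
  open Conductor Λ (m + u)

  0<m : 0 < m
  0<m = IsElem-mono-< IsElem-zero e₁ z<s

  m<m+u : m < m + u
  m<m+u = IsElem-mono-< e₁ e₂ (s<s z<s)

  members : ∀ n → n ∈ Λ ⇔ (n ≡ 0 ⊎ n ≡ m ⊎ m + u ≤ n)
  members n = mk⇔ (λ n∈Λ → map₂ (IsElem-cases e₁ e₂ n∈Λ) (IsElem-cases IsElem-zero e₁ n∈Λ z≤n))
                  [ (λ { refl → zero∈ Λ }) , [ (λ { refl → proj₁ e₁ }) , ≥conductor⇒∈ cond ]′ ]′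

  nonzero-small : ∀ {n} → n ∈ Λ → 0 < n → n < m + u → n ≡ m
  nonzero-small n∈Λ 0<n n<c =
    [ id , (λ c≤n → contradiction c≤n (<⇒≱ n<c)) ]′ (IsElem-cases e₁ e₂ n∈Λ (IsElem-next IsElem-zero e₁ n∈Λ 0<n))

  1<u : 1 < u
  1<u = +-cancelˡ-< m 1 u (subst (_< m + u) (+-comm 1 m) (∈∧<conductor⇒suc<conductor cond (proj₁ e₁) m<m+u))

  u≤m : u ≤ m
  u≤m = +-cancelˡ-≤ m u m (IsElem-next e₁ e₂ (closed Λ m m (proj₁ e₁) (proj₁ e₁)) (m<m+n m 0<m))

  gap : IsGapBitstream Λ (m + u) (bitOf (2 ^ (m + u ∸ 1) ∸ 1 ∸ 2 ^ (m ∸ 1)))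
  gap = gapBitstream cond (m ∸ 1 ∷ []) ([] ∷ [])
          (subst (_< m + u) (sym (m+[n∸m]≡n 0<m)) m<m+u ∷ [])
          (subst (_∈ Λ) (sym (m+[n∸m]≡n 0<m)) (proj₁ e₁) ∷ [])
          (λ _ 1+i∈Λ 1+i<c → here (cong (_∸ 1) (nonzero-small 1+i∈Λ z<s 1+i<c)))

  seed : IsSeedBitstream Λ (m + u) (bitOf (2 ^ (m + u) ∸ 1 ∸ 2 ^ (m ∸ u)))
  seed = seedBitstream cond (m ∸ u ∷ []) ([] ∷ [])
           ((m , m , proj₁ e₁ , proj₁ e₁ , ≤-refl , m<m+u , sym (n≤p⇒m+n+[p∸n]≡m+p u≤m)) ∷ [])
           complete
    where
    complete : ∀ i → IsSumBelow Λ (m + u) (m + u + i) → i ∈ₗ m ∸ u ∷ []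
    complete i (x , y , x∈Λ , y∈Λ , x≤y , y<c , sum)
      with nonzero-small x∈Λ (m+n≡o+p∧n<o⇒0<m sum y<c) (≤-<-trans x≤y y<c)
         | nonzero-small y∈Λ (<-≤-trans (m+n≡o+p∧n<o⇒0<m sum y<c) x≤y) y<c
    ... | refl | refl = here (m+n+o≡m+p⇒o≡p∸n m u (sym sum))

module Rank3 {Λ : NumericalSemigroup} {m u v : ℕ} (cond : IsConductor Λ (m + u + v))
             (e₁ : IsElem Λ 1 m) (e₂ : IsElem Λ 2 (m + u)) (e₃ : IsElem Λ 3 (m + u + v)) where

  open Elements Λ
  open Conductor Λ (m + u + v)

  private
    l c : ℕ
    l = m + u
    c = m + u + v

  0<m : 0 < m
  0<m = IsElem-mono-< IsElem-zero e₁ z<s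

  m<l : m < l
  m<l = IsElem-mono-< e₁ e₂ (s<s z<s)

  l<c : l < c
  l<c = IsElem-mono-< e₂ e₃ (s<s (s<s z<s))

  m<c : m < c
  m<c = <-trans m<l l<c

  members : ∀ n → n ∈ Λ ⇔ (n ≡ 0 ⊎ n ≡ m ⊎ n ≡ m + u ⊎ m + u + v ≤ n)
  members n = mk⇔
    (λ n∈Λ → map₂ (λ m≤n → map₂ (IsElem-cases e₂ e₃ n∈Λ) (IsElem-cases e₁ e₂ n∈Λ m≤n))
                  (IsElem-cases IsElem-zero e₁ n∈Λ z≤n))
    [ (λ { refl → zero∈ Λ }) , [ (λ { refl → proj₁ e₁ }) , [ (λ { refl → proj₁ e₂ }) , ≥conductor⇒∈ cond ]′ ]′ ]′

  nonzero-small : ∀ {n} → n ∈ Λ → 0 < n → n < c → n ≡ m ⊎ n ≡ l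
  nonzero-small n∈Λ 0<n n<c with IsElem-cases e₁ e₂ n∈Λ (IsElem-next IsElem-zero e₁ n∈Λ 0<n)
  ... | inj₁ n≡m = inj₁ n≡m
  ... | inj₂ l≤n = inj₂ ([ id , (λ c≤n → contradiction c≤n (<⇒≱ n<c)) ]′ (IsElem-cases e₂ e₃ n∈Λ l≤n))

  c≤-beyond-l : ∀ {n} → n ∈ Λ → l < n → c ≤ n
  c≤-beyond-l n∈Λ l<n = IsElem-next e₂ e₃ n∈Λ l<n

  2≤v : 2 ≤ v
  2≤v = +-cancelˡ-< l 1 v (subst (_< c) (+-comm 1 l) (∈∧<conductor⇒suc<conductor cond (proj₁ e₂) l<c))

  v≤m : v ≤ m
  v≤m = +-cancelˡ-≤ l v m (c≤-beyond-l (closed Λ l m (proj₁ e₂) (proj₁ e₁)) (m<m+n l 0<m))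

  u+v≤m : u < m → u + v ≤ m
  u+v≤m u<m = +-cancelˡ-≤ m (u + v) m
    (subst (_≤ m + m) (+-assoc m u v) (c≤-beyond-l (closed Λ m m (proj₁ e₁) (proj₁ e₁)) (+-monoʳ-< m u<m)))

  v≤m∸u : u < m → v ≤ m ∸ u
  v≤m∸u u<m = m+n≤o⇒m≤o∸n v (subst (_≤ m) (+-comm u v) (u+v≤m u<m))

  gap : IsGapBitstream Λ c (bitOf (2 ^ (m + u + v ∸ 1) ∸ 1 ∸ 2 ^ (m ∸ 1) ∸ 2 ^ (m + u ∸ 1)))
  gap = gapBitstream cond (m ∸ 1 ∷ l ∸ 1 ∷ []) ((<⇒≢ (∸-monoˡ-< m<l 0<m) ∷ []) ∷ [] ∷ [])
          (subst (_< c) (sym (m+[n∸m]≡n 0<m)) m<c ∷ subst (_< c) (sym (m+[n∸m]≡n 0<l)) l<c ∷ [])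
          (subst (_∈ Λ) (sym (m+[n∸m]≡n 0<m)) (proj₁ e₁) ∷ subst (_∈ Λ) (sym (m+[n∸m]≡n 0<l)) (proj₁ e₂) ∷ [])
          (λ _ 1+i∈Λ 1+i<c → [ (λ 1+i≡m → here (cong (_∸ 1) 1+i≡m)) , (λ 1+i≡l → there (here (cong (_∸ 1) 1+i≡l))) ]′
                                (nonzero-small 1+i∈Λ z<s 1+i<c))
    where
    0<l : 0 < l
    0<l = <-trans 0<m m<l

  IsSumBelow-cases : ∀ {i} → IsSumBelow Λ c (c + i) → c + i ≡ m + m ⊎ c + i ≡ m + l ⊎ c + i ≡ l + l
  IsSumBelow-cases (x , y , x∈Λ , y∈Λ , x≤y , y<c , sum)
    with nonzero-small x∈Λ (m+n≡o+p∧n<o⇒0<m sum y<c) (≤-<-trans x≤y y<c)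
       | nonzero-small y∈Λ (<-≤-trans (m+n≡o+p∧n<o⇒0<m sum y<c) x≤y) y<c
  ... | inj₁ refl | inj₁ refl = inj₁ (sym sum)
  ... | inj₁ refl | inj₂ refl = inj₂ (inj₁ (sym sum))
  ... | inj₂ refl | inj₁ refl = contradiction x≤y (<⇒≱ m<l)
  ... | inj₂ refl | inj₂ refl = inj₂ (inj₂ (sym sum))

  c+[m∸u∸v]≡m+m : u + v ≤ m → c + (m ∸ u ∸ v) ≡ m + m
  c+[m∸u∸v]≡m+m u+v≤m = trans (cong₂ _+_ (+-assoc m u v) (∸-+-assoc m u v)) (n≤p⇒m+n+[p∸n]≡m+p u+v≤m)

  c+[m∸v]≡m+l : c + (m ∸ v) ≡ m + l
  c+[m∸v]≡m+l = trans (n≤p⇒m+n+[p∸n]≡m+p v≤m) (+-comm l m)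

  c+[l∸v]≡l+l : c + (l ∸ v) ≡ l + l
  c+[l∸v]≡l+l = n≤p⇒m+n+[p∸n]≡m+p (≤-trans v≤m (<⇒≤ m<l))

  c+i≡m+m⇒i≡m∸u∸v : ∀ {i} → c + i ≡ m + m → i ≡ m ∸ u ∸ v
  c+i≡m+m⇒i≡m∸u∸v {i} eq =
    trans (m+n+o≡m+p⇒o≡p∸n m (u + v) (trans (cong (_+ i) (sym (+-assoc m u v))) eq)) (sym (∸-+-assoc m u v))

  c+i≡m+l⇒i≡m∸v : ∀ {i} → c + i ≡ m + l → i ≡ m ∸ v
  c+i≡m+l⇒i≡m∸v eq = m+n+o≡m+p⇒o≡p∸n l v (trans eq (+-comm m l))

  c+i≡l+l⇒i≡l∸v : ∀ {i} → c + i ≡ l + l → i ≡ l ∸ v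
  c+i≡l+l⇒i≡l∸v = m+n+o≡m+p⇒o≡p∸n l v

  IsSumBelow-ml : IsSumBelow Λ c (c + (m ∸ v))
  IsSumBelow-ml = m , l , proj₁ e₁ , proj₁ e₂ , <⇒≤ m<l , l<c , sym c+[m∸v]≡m+l

  IsSumBelow-ll : IsSumBelow Λ c (c + (l ∸ v))
  IsSumBelow-ll = l , l , proj₁ e₂ , proj₁ e₂ , ≤-refl , l<c , sym c+[l∸v]≡l+l

  offset-< : ∀ {p q s t} → c + p ≡ s → c + q ≡ t → s < t → p < q
  offset-< {p} {q} eq₁ eq₂ s<t = +-cancelˡ-< c p q (subst₂ _<_ (sym eq₁) (sym eq₂) s<t)

  m+l<l+l : m + l < l + l
  m+l<l+l = +-monoˡ-< l m<l

  seed-i : u < m → IsSeedBitstream Λ c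
             (bitOf (2 ^ (m + u + v) ∸ 1 ∸ 2 ^ (m ∸ u ∸ v) ∸ 2 ^ (m ∸ v) ∸ 2 ^ (m + u ∸ v)))
  seed-i u<m = seedBitstream cond (m ∸ u ∸ v ∷ m ∸ v ∷ l ∸ v ∷ [])
      ((<⇒≢ (offset-< mm c+[m∸v]≡m+l m+m<m+l) ∷ <⇒≢ (offset-< mm c+[l∸v]≡l+l (<-trans m+m<m+l m+l<l+l)) ∷ [])
        ∷ (<⇒≢ (offset-< c+[m∸v]≡m+l c+[l∸v]≡l+l m+l<l+l) ∷ []) ∷ [] ∷ [])
      ((m , m , proj₁ e₁ , proj₁ e₁ , ≤-refl , m<c , sym mm) ∷ IsSumBelow-ml ∷ IsSumBelow-ll ∷ [])
      λ _ sum → [ here ∘ c+i≡m+m⇒i≡m∸u∸v , [ there ∘ here ∘ c+i≡m+l⇒i≡m∸v , there ∘ there ∘ here ∘ c+i≡l+l⇒i≡l∸v ]′ ]′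
                  (IsSumBelow-cases sum)
    where
    mm : c + (m ∸ u ∸ v) ≡ m + m
    mm = c+[m∸u∸v]≡m+m (u+v≤m u<m)
    m+m<m+l : m + m < m + l
    m+m<m+l = +-monoʳ-< m m<l

  seed-ii : u ≡ m → IsSeedBitstream Λ c (bitOf (2 ^ (m + u + v) ∸ 1 ∸ 2 ^ (m ∸ v) ∸ 2 ^ (m + u ∸ v)))
  seed-ii u≡m = seedBitstream cond (m ∸ v ∷ l ∸ v ∷ [])
      ((<⇒≢ (offset-< c+[m∸v]≡m+l c+[l∸v]≡l+l m+l<l+l) ∷ []) ∷ [] ∷ [])
      (IsSumBelow-ml ∷ IsSumBelow-ll ∷ [])
      λ i sum → [ (λ c+i≡m+m → contradiction (subst (c ≤_) c+i≡m+m (m≤m+n c i)) (<⇒≱ m+m<c))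
                , [ here ∘ c+i≡m+l⇒i≡m∸v , there ∘ here ∘ c+i≡l+l⇒i≡l∸v ]′ ]′
                  (IsSumBelow-cases sum)
    where
    m+m<c : m + m < c
    m+m<c = subst (λ u → m + u < c) u≡m l<c

mainTheorem4 : (Λ : NumericalSemigroup) (c : ℕ) → IsConductor Λ c →
    (l₁ l₂ l₃ : ℕ) → IsElem Λ 1 l₁ → IsElem Λ 2 l₂ → IsElem Λ 3 l₃ →
    let k = rank Λ c in let m = l₁ in let u = l₂ ∸ l₁ in let v = l₃ ∸ l₂ in
    (k ≡ 1 →
        (∀ n → (n ∈ Λ) ⇔ ((n ≡ 0) ⊎ (m ≤ n)))
      × IsGapBitstream Λ c (bitOf (2 ^ (m ∸ 1) ∸ 1))
      × IsSeedBitstream Λ c (bitOf (2 ^ m ∸ 1)))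
    × (k ≡ 2 →
        (∀ n → (n ∈ Λ) ⇔ ((n ≡ 0) ⊎ (n ≡ m) ⊎ (m + u ≤ n)))
      × 1 < u × u ≤ m
      × IsGapBitstream Λ c (bitOf (2 ^ (m + u ∸ 1) ∸ 1 ∸ 2 ^ (m ∸ 1)))
      × IsSeedBitstream Λ c (bitOf (2 ^ (m + u) ∸ 1 ∸ 2 ^ (m ∸ u))))
    × (k ≡ 3 →
        (∀ n → (n ∈ Λ) ⇔ ((n ≡ 0) ⊎ (n ≡ m) ⊎ (n ≡ m + u) ⊎ (m + u + v ≤ n)))
      × (1 ≤ u → u < m →
            2 ≤ v × v ≤ m ∸ u
          × IsGapBitstream Λ c (bitOf (2 ^ (m + u + v ∸ 1) ∸ 1 ∸ 2 ^ (m ∸ 1) ∸ 2 ^ (m + u ∸ 1)))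
          × IsSeedBitstream Λ c
              (bitOf (2 ^ (m + u + v) ∸ 1 ∸ 2 ^ (m ∸ u ∸ v) ∸ 2 ^ (m ∸ v) ∸ 2 ^ (m + u ∸ v))))
      × (u ≡ m →
            2 ≤ v × v ≤ m
          × IsGapBitstream Λ c (bitOf (2 ^ (m + u + v ∸ 1) ∸ 1 ∸ 2 ^ (m ∸ 1) ∸ 2 ^ (m + u ∸ 1)))
          × IsSeedBitstream Λ c (bitOf (2 ^ (m + u + v) ∸ 1 ∸ 2 ^ (m ∸ v) ∸ 2 ^ (m + u ∸ v)))))
mainTheorem4 Λ c cond l₁ l₂ l₃ e₁ e₂ e₃ =
    (λ k≡1 → case IsElem-rank≡conductor cond k≡1 e₁ of λ where
       refl → let open Rank1 cond e₁ in members , gap , seed)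
  , (λ k≡2 → case IsElem-rank≡conductor cond k≡2 e₂′ of λ where
       refl → let open Rank2 cond e₁ e₂′ in members , 1<u , u≤m , gap , seed)
  , (λ k≡3 → case IsElem-rank≡conductor cond k≡3 e₃′ of λ where
       refl → let open Rank3 cond e₁ e₂′ e₃′ in
              members , (λ _ u<m → 2≤v , v≤m∸u u<m , gap , seed-i u<m) , (λ u≡m → 2≤v , v≤m , gap , seed-ii u≡m))
  where
  open Elements Λ
  open Conductor Λ c
  l₁≤l₂ : l₁ ≤ l₂
  l₁≤l₂ = IsElem-mono-≤ e₁ e₂ (s≤s z≤n)
  l₂≤l₃ : l₂ ≤ l₃
  l₂≤l₃ = IsElem-mono-≤ e₂ e₃ (s≤s (s≤s z≤n))
  e₂′ : IsElem Λ 2 (l₁ + (l₂ ∸ l₁))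
  e₂′ = subst (IsElem Λ 2) (sym (m+[n∸m]≡n l₁≤l₂)) e₂
  e₃′ : IsElem Λ 3 (l₁ + (l₂ ∸ l₁) + (l₃ ∸ l₂))
  e₃′ = subst (IsElem Λ 3) (sym (trans (cong (_+ (l₃ ∸ l₂)) (m+[n∸m]≡n l₁≤l₂)) (m+[n∸m]≡n l₂≤l₃))) e₃
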